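{- Let $n\ge 6$ be an integer and let $\pi=12\cdots(n-4)(n-2)(n-3)(n-1)n(n+1)\in S_{n+1}$. Then $|\mathrm{SC}_{213}^{ -1}(\pi)|=n-1$.
   Context: For a permutation $\tau=\tau_1\cdots\tau_m\in S_m$ and a pattern $\sigma\in S_3$, the consecutive-pattern-avoiding stack-sorting map $\mathrm{SC}_\sigma$ is defined as follows. Read $\tau$ from left to right, using a stack that starts empty. At each step, let $x$ be the next unread entry of the input. If the stack has fewer than two entries, or if pushing $x$ would not make the top three entries of the stack, read from top to bottom, have the same relative order as $\sigma$, then push $x$ onto the stack. Otherwise, pop the top entry of the stack and append it to the output. Once the whole input has been read, pop all remaining entries one at a time from the top and append them to the output. The output permutation is $\mathrm{SC}_\sigma(\tau)$. For $\pi\in S_{n+1}$, $\mathrm{SC}_\sigma^{ -1}(\pi)=\{\tau\in S_{n+1}:\mathrm{SC}_\sigma(\tau)=\pi\}$. -}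

module Defs where

open import Data.Nat using (ℕ; zero; suc; _∸_; _<ᵇ_)
open import Data.Bool using (Bool; true; false; if_then_else_; not; _xor_; _∧_)
open import Data.List using (List; []; _∷_; _++_; map; upTo)
open import Data.Product using (_×_; _,_; proj₁; proj₂)

_⇔ᵇ_ : Bool → Bool → Bool
p ⇔ᵇ q = not (p xor q)

-- The three entries (a , b , c) (read top to bottom after pushing) have the
-- same relative order as the pattern σ = σ₁σ₂σ₃ (all entries are distinct).
sameOrder : (σ₁ σ₂ σ₃ a b c : ℕ) → Bool
sameOrder σ₁ σ₂ σ₃ a b c =
  ((a <ᵇ b) ⇔ᵇ (σ₁ <ᵇ σ₂)) ∧ (((a <ᵇ c) ⇔ᵇ (σ₁ <ᵇ σ₃)) ∧ ((b <ᵇ c) ⇔ᵇ (σ₂ <ᵇ σ₃)))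

-- Stack is a list with its top entry first.
-- `step σ x stack` pops entries while pushing x would create the pattern σ
-- among the top three stack entries, then pushes x.
-- Returns (popped entries in output order , new stack).
step : (σ₁ σ₂ σ₃ : ℕ) → ℕ → List ℕ → List ℕ × List ℕ
step σ₁ σ₂ σ₃ x (s₁ ∷ s₂ ∷ rest) =
  if sameOrder σ₁ σ₂ σ₃ x s₁ s₂
  then (s₁ ∷ proj₁ (step σ₁ σ₂ σ₃ x (s₂ ∷ rest)) , proj₂ (step σ₁ σ₂ σ₃ x (s₂ ∷ rest)))
  else ([] , x ∷ s₁ ∷ s₂ ∷ rest)
step σ₁ σ₂ σ₃ x st = ([] , x ∷ st)

run : (σ₁ σ₂ σ₃ : ℕ) → List ℕ → List ℕ → List ℕ
run σ₁ σ₂ σ₃ [] st = st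
run σ₁ σ₂ σ₃ (x ∷ xs) st with step σ₁ σ₂ σ₃ x st
... | (o , st′) = o ++ run σ₁ σ₂ σ₃ xs st′

-- SC_σ for σ = σ₁σ₂σ₃ ∈ S₃ (given in one-line notation).
SC : (σ₁ σ₂ σ₃ : ℕ) → List ℕ → List ℕ
SC σ₁ σ₂ σ₃ τ = run σ₁ σ₂ σ₃ τ []

oneTo : ℕ → List ℕ
oneTo m = map suc (upTo m)

πₙ : ℕ → List ℕ
πₙ n = oneTo (n ∸ 4) ++ (n ∸ 2) ∷ (n ∸ 3) ∷ (n ∸ 1) ∷ n ∷ suc n ∷ []

{-# OPTIONS --safe #-}
-- Since π₍ₙ₊₁₎ is 1 followed by πₙ shifted up by one, and SC₂₁₃ only compares entries,
-- every preimage of π₍ₙ₊₁₎ arises from a preimage w of πₙ by shifting it up and inserting 1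
-- at a place from which 1 is output first; erasing that 1 from the input then erases it
-- from the output.  The 1 is output first only if nothing is popped before it and it is popped
-- by the entry right after it (or is read last).  All preimages of πₙ but one begin with a consecutive
-- 312, which leaves index 1 as the only place for the 1; the exception (`extra`) begins with
-- a 4312 and admits indices 1 and 2.  So each step from n to n + 1 adds exactly one preimage,
-- and for n = 4 an exhaustive search finds three.
module Submission where

open import Defs
open import Data.Bool using (true; false)
open import Data.Empty using (⊥-elim)
open import Data.List using (List; []; _∷_; _++_; map; length; upTo)
open import Data.List.Properties using (∷-injective; ∷-injectiveˡ; ∷-injectiveʳ; map-++; map-injective; map-upTo; length-map; ≡-dec)
open import Data.List.Membership.Propositional using (_∈_; _∉_)
open import Data.List.Membership.Propositional.Properties using (∈-map⁻; ∈-map⁺; ∈-∃++; ∈-++⁺ˡ; ∈-++⁺ʳ)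
open import Data.List.Relation.Unary.All as All using (All; []; _∷_; all?)
import Data.List.Relation.Unary.All.Properties as All
open import Data.List.Relation.Unary.Any using (here; there)
open import Data.List.Relation.Unary.Unique.Propositional using (Unique)
open import Data.List.Relation.Unary.AllPairs using ([]; _∷_)
import Data.List.Relation.Unary.Unique.Propositional.Properties as Unique
open import Data.List.Relation.Binary.Permutation.Propositional using (_↭_; prep; swap; ↭-refl; ↭-sym; ↭-trans; ↭-reflexive)
open import Data.List.Relation.Binary.Permutation.Propositional.Properties using (map⁺; ↭-map-inv; ↭-length; ∈-resp-↭; All-resp-↭; drop-mid)
open import Data.Nat using (ℕ; zero; suc; _+_; _∸_; _≤_; _<_; _<ᵇ_; s≤s; z<s; s<s; _≟_)
open import Data.Nat.Properties using (suc-injective; <⇒≤; <-trans; <-irrefl; <ᵇ⇒<; ≤-decTotalOrder)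
open import Data.List.Membership.DecPropositional (≡-dec _≟_) using (_∈?_)
open import Data.List.Sort.InsertionSort.Properties ≤-decTotalOrder using (sort-↭)
open import Data.Product using (Σ; ∃₂; _×_; _,_; proj₂)
open import Data.Sum using (_⊎_; inj₁; inj₂)
open import Function using (_∘_)
open import Function.Bundles using (_⇔_; mk⇔)
open import Relation.Nullary.Decidable using (Dec; from-yes; _→-dec_)
open import Relation.Binary.PropositionalEquality using (_≡_; _≢_; refl; sym; trans; cong; subst; module ≡-Reasoning)

true-or-false : ∀ b → b ≡ true ⊎ b ≡ false
true-or-false true = inj₁ refl
true-or-false false = inj₂ refl

1∉map-suc : ∀ {xs} → All (0 <_) xs → 1 ∉ map suc xs
1∉map-suc pos 1∈ with ∈-map⁻ suc 1∈
... | .0 , 0∈ , refl = <-irrefl refl (All.lookup pos 0∈)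

module StackSorting (σ₁ σ₂ σ₃ : ℕ) where

  runσ : List ℕ → List ℕ → List ℕ
  runσ = run σ₁ σ₂ σ₃

  run-pop : ∀ {x s₁ s₂} xs {st} → sameOrder σ₁ σ₂ σ₃ x s₁ s₂ ≡ true →
            runσ (x ∷ xs) (s₁ ∷ s₂ ∷ st) ≡ s₁ ∷ runσ (x ∷ xs) (s₂ ∷ st)
  run-pop {x} {s₁} {s₂} _ c with sameOrder σ₁ σ₂ σ₃ x s₁ s₂
  run-pop _ refl | .true = refl

  run-push : ∀ {x s₁ s₂} xs {st} → sameOrder σ₁ σ₂ σ₃ x s₁ s₂ ≡ false →
             runσ (x ∷ xs) (s₁ ∷ s₂ ∷ st) ≡ runσ xs (x ∷ s₁ ∷ s₂ ∷ st)
  run-push {x} {s₁} {s₂} _ c with sameOrder σ₁ σ₂ σ₃ x s₁ s₂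
  run-push _ refl | .false = refl

  run-push-or-pop : ∀ x st →
    (∀ xs → runσ (x ∷ xs) st ≡ runσ xs (x ∷ st)) ⊎
    (∃₂ λ s st′ → st ≡ s ∷ st′ × ∀ xs → runσ (x ∷ xs) st ≡ s ∷ runσ (x ∷ xs) st′)
  run-push-or-pop x [] = inj₁ λ _ → refl
  run-push-or-pop x (s ∷ []) = inj₁ λ _ → refl
  run-push-or-pop x (s₁ ∷ s₂ ∷ st) with true-or-false (sameOrder σ₁ σ₂ σ₃ x s₁ s₂)
  ... | inj₁ c = inj₂ (s₁ , s₂ ∷ st , refl , λ xs → run-pop {x} {s₁} {s₂} xs c)
  ... | inj₂ c = inj₁ λ xs → run-push {x} {s₁} {s₂} xs c

  -- The machine only compares entries, and suc preserves comparisons.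
  run-map-suc : ∀ xs st → runσ (map suc xs) (map suc st) ≡ map suc (runσ xs st)
  run-map-suc [] st = refl
  run-map-suc (x ∷ xs) = reading
    where
    open ≡-Reasoning
    reading : ∀ st → runσ (map suc (x ∷ xs)) (map suc st) ≡ map suc (runσ (x ∷ xs) st)
    reading [] = run-map-suc xs (x ∷ [])
    reading (s ∷ []) = run-map-suc xs (x ∷ s ∷ [])
    reading (s₁ ∷ st@(s₂ ∷ _)) with true-or-false (sameOrder σ₁ σ₂ σ₃ x s₁ s₂) | reading st
    ... | inj₁ c | ih = begin
      runσ (map suc (x ∷ xs)) (map suc (s₁ ∷ st))    ≡⟨ run-pop {suc x} {suc s₁} {suc s₂} (map suc xs) c ⟩
      suc s₁ ∷ runσ (map suc (x ∷ xs)) (map suc st) ≡⟨ cong (suc s₁ ∷_) ih ⟩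
      suc s₁ ∷ map suc (runσ (x ∷ xs) st)           ≡⟨ cong (map suc) (run-pop {x} {s₁} {s₂} xs c) ⟨
      map suc (runσ (x ∷ xs) (s₁ ∷ st))             ∎
    ... | inj₂ c | _ = begin
      runσ (map suc (x ∷ xs)) (map suc (s₁ ∷ st)) ≡⟨ run-push {suc x} {suc s₁} {suc s₂} (map suc xs) c ⟩
      runσ (map suc xs) (map suc (x ∷ s₁ ∷ st))   ≡⟨ run-map-suc xs (x ∷ s₁ ∷ st) ⟩
      map suc (runσ xs (x ∷ s₁ ∷ st))             ≡⟨ cong (map suc) (run-push {x} {s₁} {s₂} xs c) ⟨
      map suc (runσ (x ∷ xs) (s₁ ∷ st))           ∎

  SC-map-suc : ∀ xs → SC σ₁ σ₂ σ₃ (map suc xs) ≡ map suc (SC σ₁ σ₂ σ₃ xs)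
  SC-map-suc xs = run-map-suc xs []

  run-head-∈ : ∀ xs {s st y r} → runσ xs (s ∷ st) ≡ y ∷ r → y ∈ s ∷ xs
  run-head-∈ [] refl = here refl
  run-head-∈ (x ∷ xs) {s} {st} e with run-push-or-pop x (s ∷ st)
  ... | inj₁ push = there (run-head-∈ xs (trans (sym (push xs)) e))
  ... | inj₂ (.s , st′ , refl , pop) = here (∷-injectiveˡ (trans (sym e) (pop xs)))

  run-head-≢ : ∀ {v s xs st r} → v ∉ s ∷ xs → runσ xs (s ∷ st) ≢ v ∷ r
  run-head-≢ v∉ e = v∉ (run-head-∈ _ e)

  run-map-suc-head≢1 : ∀ {x} xs st {r} → All (0 <_) (x ∷ xs) →
                       runσ (map suc xs) (suc x ∷ st) ≢ 1 ∷ r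
  run-map-suc-head≢1 xs st pos = run-head-≢ (1∉map-suc pos)

  -- If v is output first, then v is popped as soon as the entry after it arrives,
  -- leaving the stack exactly as it would be had v never been read.
  run-erase-first : ∀ {v} P Q {st r} → v ∉ P → v ∉ Q → v ∉ st →
                    runσ (P ++ v ∷ Q) st ≡ v ∷ r → r ≡ runσ (P ++ Q) st
  run-erase-first {v} (y ∷ P) Q {st} v∉yP v∉Q v∉st e with run-push-or-pop y st
  ... | inj₁ push =
    trans (run-erase-first P Q (v∉yP ∘ there) v∉Q v∉y∷st (trans (sym (push (P ++ v ∷ Q))) e))
          (sym (push (P ++ Q)))
    where
    v∉y∷st : v ∉ y ∷ st
    v∉y∷st (here v≡y) = v∉yP (here v≡y)
    v∉y∷st (there v∈st) = v∉st v∈st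
  ... | inj₂ (s , st′ , refl , pop) =
    ⊥-elim (v∉st (here (∷-injectiveˡ (trans (sym e) (pop (P ++ v ∷ Q))))))
  run-erase-first {v} [] Q {st} _ v∉Q v∉st e with run-push-or-pop v st
  ... | inj₂ (s , st′ , refl , pop) = ⊥-elim (v∉st (here (∷-injectiveˡ (trans (sym e) (pop Q)))))
  ... | inj₁ push with Q | trans (sym (push Q)) e
  ...   | [] | e′ = sym (∷-injectiveʳ e′)
  ...   | x ∷ Q′ | e′ with run-push-or-pop x (v ∷ st)
  ...     | inj₁ push′ = ⊥-elim (run-head-≢ v∉Q (trans (sym (push′ Q′)) e′))
  ...     | inj₂ (.v , .st , refl , pop) = ∷-injectiveʳ (trans (sym e′) (pop Q′))

open StackSorting 2 1 3

<ᵇ-true : ∀ {m n} → m < n → (m <ᵇ n) ≡ true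
<ᵇ-true {zero} {suc n} _ = refl
<ᵇ-true {suc m} {suc n} (s≤s m<n) = <ᵇ-true m<n

<ᵇ-false : ∀ {m n} → n ≤ m → (m <ᵇ n) ≡ false
<ᵇ-false {m} {zero} _ = refl
<ᵇ-false {suc m} {suc n} (s≤s n≤m) = <ᵇ-false n≤m

run₂₁₃-pop : ∀ {x s₁ s₂} xs {st} → s₁ < x → x < s₂ →
             runσ (x ∷ xs) (s₁ ∷ s₂ ∷ st) ≡ s₁ ∷ runσ (x ∷ xs) (s₂ ∷ st)
run₂₁₃-pop {x} {s₁} {s₂} xs s₁<x x<s₂ = run-pop {x} {s₁} {s₂} xs pops
  where
  pops : sameOrder 2 1 3 x s₁ s₂ ≡ true
  pops rewrite <ᵇ-false {x} {s₁} (<⇒≤ s₁<x) | <ᵇ-true x<s₂ | <ᵇ-true (<-trans s₁<x x<s₂) = refl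

run₂₁₃-push-below : ∀ {x s₁} s₂ xs {st} → x < s₁ →
                    runσ (x ∷ xs) (s₁ ∷ s₂ ∷ st) ≡ runσ xs (x ∷ s₁ ∷ s₂ ∷ st)
run₂₁₃-push-below {x} {s₁} s₂ xs x<s₁ = run-push {x} {s₁} {s₂} xs pushes
  where
  pushes : sameOrder 2 1 3 x s₁ s₂ ≡ false
  pushes rewrite <ᵇ-true x<s₁ = refl

run₂₁₃-push-above : ∀ {x s₂} s₁ xs {st} → s₂ < x →
                    runσ (x ∷ xs) (s₁ ∷ s₂ ∷ st) ≡ runσ xs (x ∷ s₁ ∷ s₂ ∷ st)
run₂₁₃-push-above {x} {s₂} s₁ xs s₂<x = run-push {x} {s₁} {s₂} xs pushes
  where
  pushes : sameOrder 2 1 3 x s₁ s₂ ≡ false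
  pushes with x <ᵇ s₁
  ... | true = refl
  ... | false rewrite <ᵇ-false {x} {s₂} (<⇒≤ s₂<x) = refl

insertOne : ℕ → List ℕ → List ℕ
insertOne zero w = 1 ∷ map suc w
insertOne (suc i) [] = 1 ∷ []
insertOne (suc i) (x ∷ w) = suc x ∷ insertOne i w

insertOne-↭ : ∀ i w → insertOne i w ↭ 1 ∷ map suc w
insertOne-↭ zero w = ↭-refl
insertOne-↭ (suc i) [] = ↭-refl
insertOne-↭ (suc i) (x ∷ w) = ↭-trans (prep (suc x) (insertOne-↭ i w)) (swap (suc x) 1 ↭-refl)

insertOne-≢[] : ∀ i w → insertOne i w ≢ []
insertOne-≢[] zero w ()
insertOne-≢[] (suc i) [] ()
insertOne-≢[] (suc i) (x ∷ w) ()

insertOne-injective : ∀ i {v w} → insertOne i v ≡ insertOne i w → v ≡ w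
insertOne-injective zero e = map-injective suc-injective (∷-injectiveʳ e)
insertOne-injective (suc i) {[]} {[]} e = refl
insertOne-injective (suc i) {[]} {y ∷ w} e = ⊥-elim (insertOne-≢[] i w (sym (∷-injectiveʳ e)))
insertOne-injective (suc i) {x ∷ v} {[]} e = ⊥-elim (insertOne-≢[] i v (∷-injectiveʳ e))
insertOne-injective (suc i) {x ∷ v} {y ∷ w} e with ∷-injective e
... | refl , e′ = cong (x ∷_) (insertOne-injective i e′)

++-insertOne : ∀ P {Q w} → P ++ Q ≡ map suc w → P ++ 1 ∷ Q ≡ insertOne (length P) w
++-insertOne [] e = cong (1 ∷_) e
++-insertOne (p ∷ P) {w = x ∷ w} e with ∷-injective e
... | refl , e′ = cong (suc x ∷_) (++-insertOne P e′)

data Starts21 : List ℕ → Set where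
  starts21 : ∀ {a b} R → 0 < b → b < a → Starts21 (a ∷ b ∷ R)

data Starts312 : List ℕ → Set where
  starts312 : ∀ {a b c} R → 0 < b → b < c → c < a → Starts312 (a ∷ b ∷ c ∷ R)

data Starts4312 : List ℕ → Set where
  starts4312 : ∀ {a b} w → Starts312 (b ∷ w) → b < a → Starts4312 (a ∷ b ∷ w)

starts312⇒starts21 : ∀ {w} → Starts312 w → Starts21 w
starts312⇒starts21 (starts312 R 0<b b<c c<a) = starts21 _ 0<b (<-trans b<c c<a)

starts4312⇒starts21 : ∀ {w} → Starts4312 w → Starts21 w
starts4312⇒starts21 (starts4312 w (starts312 R 0<c c<d d<b) b<a) =
  starts21 _ (<-trans 0<c (<-trans c<d d<b)) b<a

insertOne₁-starts312 : ∀ {w} → Starts21 w → Starts312 (insertOne 1 w)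
insertOne₁-starts312 (starts21 R 0<b b<a) = starts312 _ z<s (s<s 0<b) (s<s b<a)

insertOne₂-starts4312 : ∀ {w} → Starts4312 w → Starts4312 (insertOne 2 w)
insertOne₂-starts4312 (starts4312 w (starts312 R 0<c c<d d<b) b<a) =
  starts4312 _ (starts312 _ z<s (s<s 0<c) (s<s (<-trans c<d d<b))) (s<s b<a)

suc≢1 : ∀ {b} {xs ys : List ℕ} → 0 < b → suc b ∷ xs ≢ 1 ∷ ys
suc≢1 0<b refl = <-irrefl refl 0<b

SC-insertOne₁ : ∀ {w} → Starts21 w → SC 2 1 3 (insertOne 1 w) ≡ 1 ∷ map suc (SC 2 1 3 w)
SC-insertOne₁ {a ∷ b ∷ R} (starts21 R 0<b b<a) =
  trans (run₂₁₃-pop (map suc R) (s<s 0<b) (s<s b<a)) (cong (1 ∷_) (SC-map-suc (a ∷ b ∷ R)))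

SC-insertOne₂ : ∀ {a w} → Starts21 w →
                SC 2 1 3 (insertOne 2 (a ∷ w)) ≡ 1 ∷ map suc (SC 2 1 3 (a ∷ w))
SC-insertOne₂ {a} {b ∷ c ∷ R} (starts21 R 0<c c<b) = begin
  SC 2 1 3 (insertOne 2 (a ∷ b ∷ c ∷ R))
    ≡⟨ run₂₁₃-push-below (suc a) (suc c ∷ map suc R) (s<s (<-trans 0<c c<b)) ⟩
  runσ (suc c ∷ map suc R) (1 ∷ suc b ∷ suc a ∷ [])
    ≡⟨ run₂₁₃-pop (map suc R) (s<s 0<c) (s<s c<b) ⟩
  1 ∷ SC 2 1 3 (map suc (a ∷ b ∷ c ∷ R))
    ≡⟨ cong (1 ∷_) (SC-map-suc (a ∷ b ∷ c ∷ R)) ⟩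
  1 ∷ map suc (SC 2 1 3 (a ∷ b ∷ c ∷ R)) ∎
  where open ≡-Reasoning

insertOne-312-position : ∀ i {w r} → Starts312 w → All (0 <_) w →
                         SC 2 1 3 (insertOne i w) ≡ 1 ∷ r → i ≡ 1
insertOne-312-position zero (starts312 R _ _ _) pos e =
  ⊥-elim (run-map-suc-head≢1 (_ ∷ _ ∷ R) (1 ∷ []) pos e)
insertOne-312-position (suc zero) _ _ _ = refl
insertOne-312-position (suc (suc zero)) {a ∷ b ∷ c ∷ R} {r} 
  (starts312 R 0<b b<c c<a) (_ ∷ _ ∷ 0<c ∷ pos) e =
  ⊥-elim (run-map-suc-head≢1 R (1 ∷ suc b ∷ suc a ∷ []) (0<c ∷ pos) (begin
    runσ (map suc R) (suc c ∷ 1 ∷ suc b ∷ suc a ∷ []) ≡⟨ run₂₁₃-push-above 1 (map suc R) (s<s b<c) ⟨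
    runσ (suc c ∷ map suc R) (1 ∷ suc b ∷ suc a ∷ []) ≡⟨ run₂₁₃-push-below (suc a) (suc c ∷ map suc R) (s<s 0<b) ⟨
    SC 2 1 3 (insertOne 2 (a ∷ b ∷ c ∷ R))            ≡⟨ e ⟩
    1 ∷ r                                             ∎))
  where open ≡-Reasoning
insertOne-312-position (suc (suc (suc j))) (starts312 R 0<b b<c c<a) _ e =
  ⊥-elim (suc≢1 0<b (trans (sym (run₂₁₃-pop (insertOne j R) (s<s b<c) (s<s c<a))) e))

insertOne-∷312-position : ∀ i {a w r} → Starts312 w → All (0 <_) (a ∷ w) →
                          SC 2 1 3 (insertOne i (a ∷ w)) ≡ 1 ∷ r → i ≡ 1 ⊎ i ≡ 2
insertOne-∷312-position zero (starts312 R _ _ _) pos e =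
  ⊥-elim (run-map-suc-head≢1 (_ ∷ _ ∷ _ ∷ R) (1 ∷ []) pos e)
insertOne-∷312-position (suc zero) _ _ _ = inj₁ refl
insertOne-∷312-position (suc (suc zero)) _ _ _ = inj₂ refl
insertOne-∷312-position (suc (suc (suc zero))) {a} {b ∷ c ∷ d ∷ R} {r}
  (starts312 R 0<c c<d d<b) (_ ∷ _ ∷ _ ∷ 0<d ∷ pos) e =
  ⊥-elim (run-map-suc-head≢1 R (1 ∷ suc c ∷ suc b ∷ suc a ∷ []) (0<d ∷ pos) (begin
    runσ (map suc R) (suc d ∷ 1 ∷ suc c ∷ suc b ∷ suc a ∷ [])
      ≡⟨ run₂₁₃-push-above 1 (map suc R) (s<s c<d) ⟨
    runσ (suc d ∷ map suc R) (1 ∷ suc c ∷ suc b ∷ suc a ∷ [])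
      ≡⟨ run₂₁₃-push-below (suc b) (suc d ∷ map suc R) (s<s 0<c) ⟨
    runσ (1 ∷ suc d ∷ map suc R) (suc c ∷ suc b ∷ suc a ∷ [])
      ≡⟨ run₂₁₃-push-below (suc a) (1 ∷ suc d ∷ map suc R) (s<s (<-trans c<d d<b)) ⟨
    SC 2 1 3 (insertOne 3 (a ∷ b ∷ c ∷ d ∷ R))
      ≡⟨ e ⟩
    1 ∷ r ∎))
  where open ≡-Reasoning
insertOne-∷312-position (suc (suc (suc (suc j)))) {a} {b ∷ c ∷ d ∷ R}
  (starts312 R 0<c c<d d<b) _ e =
  ⊥-elim (suc≢1 0<c (trans (sym (begin
    SC 2 1 3 (insertOne (4 + j) (a ∷ b ∷ c ∷ d ∷ R))
      ≡⟨ run₂₁₃-push-below (suc a) (suc d ∷ insertOne j R) (s<s (<-trans c<d d<b)) ⟩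
    runσ (suc d ∷ insertOne j R) (suc c ∷ suc b ∷ suc a ∷ [])
      ≡⟨ run₂₁₃-pop (insertOne j R) (s<s c<d) (s<s d<b) ⟩
    suc c ∷ runσ (suc d ∷ insertOne j R) (suc b ∷ suc a ∷ []) ∎)) e))
  where open ≡-Reasoning

oneTo-suc : ∀ k → oneTo (suc k) ≡ 1 ∷ map suc (oneTo k)
oneTo-suc k = cong (λ xs → 1 ∷ map suc xs) (sym (map-upTo suc k))

oneTo-positive : ∀ k → All (0 <_) (oneTo k)
oneTo-positive k = All.map⁺ (All.universal (λ _ → z<s) (upTo k))

πₙ-suc : ∀ m → πₙ (5 + m) ≡ 1 ∷ map suc (πₙ (4 + m))
πₙ-suc m = trans (cong (_++ map suc top) (oneTo-suc m)) (cong (1 ∷_) (sym (map-++ suc (oneTo m) top)))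
  where
  top : List ℕ
  top = 2 + m ∷ 1 + m ∷ 3 + m ∷ 4 + m ∷ 5 + m ∷ []

Preimage : ℕ → List ℕ → Set
Preimage n τ = τ ↭ oneTo (suc n) × SC 2 1 3 τ ≡ πₙ n

preimage-positive : ∀ {n τ} → Preimage n τ → All (0 <_) τ
preimage-positive {n} (τ↭ , _) = All-resp-↭ (↭-sym τ↭) (oneTo-positive (suc n))

preimage-insertOne : ∀ m i {w} → Preimage (4 + m) w →
  SC 2 1 3 (insertOne i w) ≡ 1 ∷ map suc (SC 2 1 3 w) → Preimage (5 + m) (insertOne i w)
preimage-insertOne m i {w} (w↭ , SCw) SC-ins =
  ↭-trans (insertOne-↭ i w) (↭-trans (prep 1 (map⁺ suc w↭)) (↭-reflexive (sym (oneTo-suc _)))) ,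
  trans SC-ins (trans (cong (λ π → 1 ∷ map suc π) SCw) (sym (πₙ-suc m)))

preimage-suc-inv : ∀ m {τ} → Preimage (5 + m) τ →
                   ∃₂ λ i w → τ ≡ insertOne i w × Preimage (4 + m) w
preimage-suc-inv m (τ↭ , SCτ) with ∈-∃++ (∈-resp-↭ (↭-sym τ↭) (here refl))
... | P , Q , refl with ↭-map-inv suc (↭-sym (drop-mid P [] (↭-trans τ↭ (↭-reflexive (oneTo-suc _)))))
... | w , PQ≡ , ↭w = length P , w , ++-insertOne P PQ≡ , ↭-sym ↭w , SCw
  where
  1∉PQ : 1 ∉ P ++ Q
  1∉PQ 1∈ = 1∉map-suc (All-resp-↭ ↭w (oneTo-positive (5 + m))) (subst (1 ∈_) PQ≡ 1∈)
  erased : map suc (πₙ (4 + m)) ≡ SC 2 1 3 (P ++ Q)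
  erased = run-erase-first P Q (1∉PQ ∘ ∈-++⁺ˡ) (1∉PQ ∘ ∈-++⁺ʳ P) (λ ()) (trans SCτ (πₙ-suc m))
  SCw : SC 2 1 3 w ≡ πₙ (4 + m)
  SCw = map-injective suc-injective (begin
    map suc (SC 2 1 3 w)   ≡⟨ SC-map-suc w ⟨
    SC 2 1 3 (map suc w)   ≡⟨ cong (SC 2 1 3) PQ≡ ⟨
    SC 2 1 3 (P ++ Q)      ≡⟨ erased ⟨
    map suc (πₙ (4 + m))   ∎)
    where open ≡-Reasoning

extra : ℕ → List ℕ
extra zero = 5 ∷ 4 ∷ 2 ∷ 3 ∷ 1 ∷ []
extra (suc m) = insertOne 2 (extra m)

others : ℕ → List (List ℕ)
others zero = (5 ∷ 2 ∷ 4 ∷ 1 ∷ 3 ∷ []) ∷ (5 ∷ 2 ∷ 4 ∷ 3 ∷ 1 ∷ []) ∷ []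
others (suc m) = map (insertOne 1) (extra m ∷ others m)

preimages : ℕ → List (List ℕ)
preimages m = extra m ∷ others m

extra-starts4312 : ∀ m → Starts4312 (extra m)
extra-starts4312 zero = starts4312 _ (starts312 _ (<ᵇ⇒< _ _ _) (<ᵇ⇒< _ _ _) (<ᵇ⇒< _ _ _)) (<ᵇ⇒< _ _ _)
extra-starts4312 (suc m) = insertOne₂-starts4312 (extra-starts4312 m)

others-starts312 : ∀ m → All Starts312 (others m)
preimages-starts21 : ∀ m → All Starts21 (preimages m)

others-starts312 zero =
  starts312 _ (<ᵇ⇒< _ _ _) (<ᵇ⇒< _ _ _) (<ᵇ⇒< _ _ _) ∷ starts312 _ (<ᵇ⇒< _ _ _) (<ᵇ⇒< _ _ _) (<ᵇ⇒< _ _ _) ∷ []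
others-starts312 (suc m) = All.map⁺ (All.map insertOne₁-starts312 (preimages-starts21 m))

preimages-starts21 m =
  starts4312⇒starts21 (extra-starts4312 m) ∷ All.map starts312⇒starts21 (others-starts312 m)

preimages-length : ∀ m → length (preimages m) ≡ 3 + m
preimages-length zero = refl
preimages-length (suc m) = cong suc (trans (length-map (insertOne 1) (preimages m)) (preimages-length m))

insertOne₂≢insertOne₁ : ∀ {v} w → Starts21 v → insertOne 2 v ≢ insertOne 1 w
insertOne₂≢insertOne₁ [] (starts21 R _ _) ()
insertOne₂≢insertOne₁ (x ∷ w) (starts21 R 0<b _) e = suc≢1 0<b (∷-injectiveʳ e)

preimages-unique : ∀ m → Unique (preimages m)
preimages-unique zero = ((λ ()) ∷ (λ ()) ∷ []) ∷ ((λ ()) ∷ []) ∷ [] ∷ []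
preimages-unique (suc m) =
  All.map⁺ (All.universal extra≢ (preimages m)) ∷ Unique.map⁺ (insertOne-injective 1) (preimages-unique m)
  where
  extra≢ : ∀ w → extra (suc m) ≢ insertOne 1 w
  extra≢ w = insertOne₂≢insertOne₁ w (starts4312⇒starts21 (extra-starts4312 m))

AllTuples : {A : Set} → List A → ℕ → (List A → Set) → Set
AllTuples D zero Q = Q []
AllTuples D (suc k) Q = All (λ x → AllTuples D k (Q ∘ (x ∷_))) D

allTuples? : ∀ {A : Set} (D : List A) k {Q : List A → Set} →
             (∀ xs → Dec (Q xs)) → Dec (AllTuples D k Q)
allTuples? D zero Q? = Q? []
allTuples? D (suc k) Q? = all? (λ x → allTuples? D k (Q? ∘ (x ∷_))) D

allTuples-lookup : ∀ {A : Set} {D : List A} {k} {Q : List A → Set} xs → length xs ≡ k →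
                   AllTuples D k Q → All (_∈ D) xs → Q xs
allTuples-lookup [] refl q [] = q
allTuples-lookup (x ∷ xs) refl q (x∈ ∷ xs∈) = allTuples-lookup xs refl (All.lookup q x∈) xs∈

preimages-complete₀ : ∀ τ → length τ ≡ 5 → All (_∈ oneTo 5) τ → SC 2 1 3 τ ≡ πₙ 4 → τ ∈ preimages 0
preimages-complete₀ τ len τ⊆ = allTuples-lookup {Q = Claim} τ len (from-yes (allTuples? (oneTo 5) 5 claim?)) τ⊆
  where
  Claim : List ℕ → Set
  Claim τ = SC 2 1 3 τ ≡ πₙ 4 → τ ∈ preimages 0
  claim? : ∀ τ → Dec (Claim τ)
  claim? τ = ≡-dec _≟_ (SC 2 1 3 τ) (πₙ 4) →-dec τ ∈? preimages 0

preimages-sound : ∀ m → All (Preimage (4 + m)) (preimages m)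
-- Insertion sort evaluates, so `sort xs` is definitionally `oneTo 5` here.
preimages-sound zero =
  (↭-sym (sort-↭ _) , refl) ∷ (↭-sym (sort-↭ _) , refl) ∷ (↭-sym (sort-↭ _) , refl) ∷ []
preimages-sound (suc m) =
  extra-sound ∷ All.map⁺ (All.zipWith others-sound (preimages-sound m , preimages-starts21 m))
  where
  extra-sound : Preimage (5 + m) (extra (suc m))
  extra-sound with extra m | extra-starts4312 m | All.head (preimages-sound m)
  ... | _ | starts4312 _ s312 _ | p = preimage-insertOne m 2 p (SC-insertOne₂ (starts312⇒starts21 s312))
  others-sound : ∀ {w} → Preimage (4 + m) w × Starts21 w → Preimage (5 + m) (insertOne 1 w)
  others-sound (p , s21) = preimage-insertOne m 1 p (SC-insertOne₁ s21)

preimages-complete : ∀ m {τ} → Preimage (4 + m) τ → τ ∈ preimages m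
preimages-complete zero {τ} (τ↭ , SCτ) =
  preimages-complete₀ τ (↭-length τ↭) (All.tabulate (∈-resp-↭ τ↭)) SCτ
preimages-complete (suc m) p with preimage-suc-inv m p
... | i , w , refl , pw =
  insertion-position (preimages-complete m pw) (preimage-positive pw) (trans (proj₂ p) (πₙ-suc m))
  where
  insertion-position : ∀ {w r} → w ∈ preimages m → All (0 <_) w →
                       SC 2 1 3 (insertOne i w) ≡ 1 ∷ r → insertOne i w ∈ preimages (suc m)
  insertion-position (here refl) pos e with extra m | extra-starts4312 m
  ... | _ | starts4312 _ s312 _ with insertOne-∷312-position i s312 pos e
  ...   | inj₁ refl = there (here refl)
  ...   | inj₂ refl = here refl
  insertion-position (there w∈) pos e with insertOne-312-position i (All.lookup (others-starts312 m) w∈) pos e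
  ... | refl = there (there (∈-map⁺ (insertOne 1) w∈))

mainTheorem8 : (n : ℕ) → 6 ≤ n →
    Σ (List (List ℕ)) (λ L → Unique L × length L ≡ n ∸ 1 ×
      ((τ : List ℕ) → (τ ∈ L) ⇔ ((τ ↭ oneTo (suc n)) × SC 2 1 3 τ ≡ πₙ n)))
mainTheorem8 _ (s≤s (s≤s (s≤s (s≤s {n = m} _)))) =
  preimages m , preimages-unique m , preimages-length m ,
  λ τ → mk⇔ (All.lookup (preimages-sound m)) (preimages-complete m)
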